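{- Let $k\geq 2$ and let $(X,Y)$ be an exact vertical $k$-separation of a simple binary chordal matroid $M$. Let $G=\mathrm{cl}_M(X)\cap\mathrm{cl}_M(Y)$. Then $r_M(G)=k-1$.
   Context: A vertical $k$-separation of $M$ is a partition $(X,Y)$ of $E(M)$ with $r(X)+r(Y)-r(M)\leq k-1$ and $\min\{r(X),r(Y)\}\geq k$; it is exact if $r(X)+r(Y)-r(M)=k-1$. A matroid $M$ is chordal if, for every circuit $D$ of $M$ with at least four elements, there exist circuits $D_1,D_2$ and an element $e$ with $D_1\cap D_2=\{e\}$ and $D=(D_1\cup D_2)-e$. -}

module Defs where

open import Data.Bool using (Bool; true; false; _∧_; _∨_; not; _xor_; if_then_else_)
open import Data.Nat using (ℕ; zero; suc; _⊔_; _≡ᵇ_; _+_; _∸_; _≤_; _⊓_)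
open import Data.List using (List; []; _∷_; map; _++_; foldr)
open import Data.Bool.ListAction using (any)
open import Data.Vec using (Vec; []; _∷_; replicate; zipWith; tabulate)
open import Data.Fin using (Fin)
open import Data.Fin.Subset using (Subset; inside; outside; ∣_∣; _∪_; _∩_; ⁅_⁆; _⊂_; _-_; ∁)
open import Data.Product using (_×_; ∃-syntax)
open import Relation.Binary.PropositionalEquality using (_≡_)

-- A binary matroid on ground set E = Fin n, given by a GF(2)-representation:
-- column e is a vector in GF(2)^m (GF(2) = Bool, addition = xor).
BinRep : ℕ → ℕ → Set
BinRep n m = Vec (Vec Bool m) n

sumSel : ∀ {n m} → BinRep n m → Subset n → Vec Bool m
sumSel {m = m} [] [] = replicate m false
sumSel (a ∷ as) (true ∷ s) = zipWith _xor_ a (sumSel as s)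
sumSel (a ∷ as) (false ∷ s) = sumSel as s

isZero : ∀ {m} → Vec Bool m → Bool
isZero [] = true
isZero (b ∷ v) = not b ∧ isZero v

nonemptyᵇ : ∀ {n} → Subset n → Bool
nonemptyᵇ [] = false
nonemptyᵇ (b ∷ s) = b ∨ nonemptyᵇ s

_⊆ᵇ_ : ∀ {n} → Subset n → Subset n → Bool
[] ⊆ᵇ [] = true
(a ∷ s) ⊆ᵇ (b ∷ t) = (not a ∨ b) ∧ (s ⊆ᵇ t)

allSubsets : ∀ n → List (Subset n)
allSubsets zero = [] ∷ []
allSubsets (suc n) = map (inside ∷_) (allSubsets n) ++ map (outside ∷_) (allSubsets n)

indepᵇ : ∀ {n m} → BinRep n m → Subset n → Bool
indepᵇ {n} A I = not (any (λ T → (T ⊆ᵇ I) ∧ (nonemptyᵇ T ∧ isZero (sumSel A T))) (allSubsets n))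

Independent : ∀ {n m} → BinRep n m → Subset n → Set
Independent A I = indepᵇ A I ≡ true

rank : ∀ {n m} → BinRep n m → Subset n → ℕ
rank {n} A X = foldr (λ I k → (if (I ⊆ᵇ X) ∧ indepᵇ A I then ∣ I ∣ else 0) ⊔ k) 0 (allSubsets n)

rankM : ∀ {n m} → BinRep n m → ℕ
rankM {n} A = rank A (replicate n true)

cl : ∀ {n m} → BinRep n m → Subset n → Subset n
cl A X = tabulate (λ e → rank A (X ∪ ⁅ e ⁆) ≡ᵇ rank A X)

Circuit : ∀ {n m} → BinRep n m → Subset n → Set
Circuit A C = (indepᵇ A C ≡ false) × (∀ T → T ⊂ C → Independent A T)

Simple : ∀ {n m} → BinRep n m → Set
Simple A = ∀ C → Circuit A C → 3 ≤ ∣ C ∣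

Chordal : ∀ {n m} → BinRep n m → Set
Chordal {n} A = ∀ D → Circuit A D → 4 ≤ ∣ D ∣ →
  ∃[ D₁ ] ∃[ D₂ ] ∃[ e ] (Circuit A D₁ × Circuit A D₂ × (D₁ ∩ D₂ ≡ ⁅ e ⁆) × (D ≡ (D₁ ∪ D₂) - e))

VerticalSep : ∀ {n m} → BinRep n m → ℕ → Subset n → Subset n → Set
VerticalSep A k X Y =
  (Y ≡ ∁ X) × (rank A X + rank A Y ≤ rankM A + (k ∸ 1)) × (k ≤ rank A X ⊓ rank A Y)

ExactVerticalSep : ∀ {n m} → BinRep n m → ℕ → Subset n → Subset n → Set
ExactVerticalSep A k X Y =
  VerticalSep A k X Y × (rank A X + rank A Y ≡ rankM A + (k ∸ 1))

{-# OPTIONS --safe #-}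
-- Work in the cycle space of the GF(2)-representation.  For every cycle S, the sum of the
-- columns of S ∩ X lies in the span of G = cl X ∩ cl Y.  The proof is by induction on |S|:
-- a cycle is either a circuit or the symmetric difference of two smaller cycles; if a circuit
-- meets X or Y in a single element e, its two sides have equal sums and so e ∈ G; a circuit
-- meeting both X and Y in at least two elements has at least four elements, so chordality
-- writes it as D₁ ⊕ D₂ with circuits D₁, D₂, and simplicity makes them smaller.  Hence span X ∩ span Y = span G, and the dimension formula for subspaces
-- gives r(G) + r(M) = r(X) + r(Y) for every partition (X, Y) of the ground set.  Exactness
-- then yields r(G) = k - 1.
module Submission where

open import Defs
open import Data.Nat using (ℕ; _≤_; _∸_)
open import Data.Fin.Subset using (Subset; _∩_)
open import Relation.Binary.PropositionalEquality using (_≡_)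

open import Algebra.Bundles using (AbelianGroup)
open import Algebra.Structures using (IsAbelianGroup)
open import Data.Bool using (Bool; true; false; _xor_; _∧_; not; T; if_then_else_)
open import Data.Bool.ListAction using (any)
open import Data.Bool.Properties
  using (xor-assoc; xor-comm; xor-identityˡ; xor-identityʳ; xor-same; ∧-distribʳ-xor; T-∧; T-∨; T-≡; not-injective)
  renaming (_≟_ to _≟ᵇ_)
open import Data.Empty using (⊥-elim)
open import Data.Fin using (Fin; zero; suc; _≟_)
open import Data.Fin.Subset using (_∈_; _∉_; _⊆_; _⊂_; _∪_; _─_; _-_; ∁; ⁅_⁆; ∣_∣; ⊥; Nonempty; Empty)
open import Data.Fin.Subset.Properties
  using ( _∈?_; _⊂?_; nonempty?; anySubset?; drop-there; drop-∷-⊆; Empty-unique; ∉⊥; ⊥⊆; ⊆-refl; ⊆-antisym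
        ; ⊆-⊂-trans; x∈⁅x⁆; x∈⁅y⁆⇒x≡y; x≢y⇒x∉⁅y⁆; ∣⁅x⁆∣≡1; p⊆q⇒∣p∣≤∣q∣; p⊂q⇒∣p∣<∣q∣
        ; p⊆p∪q; q⊆p∪q; x∈p∪q⁻; p∩q⊆p; p∩q⊆q; x∈p∩q⁺; x∈p∩q⁻; x∈∁p⇒x∉p; x∉p⇒x∈∁p
        ; p─⊥≡p; ∩-comm; p∪∁p≡⊤ )
open import Data.List using ([]; _∷_; foldr; allFin)
import Data.List as List
import Data.List.Membership.Propositional as List
open import Data.List.Membership.Propositional.Properties using (∈-map⁺; ∈-++⁺ˡ; ∈-++⁺ʳ; ∈-allFin)
open import Data.List.Relation.Unary.Any using (satisfied) renaming (here to hereᴸ; there to thereᴸ)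
open import Data.List.Relation.Unary.Any.Properties using (any⁺; any⁻)
open import Data.Nat using (zero; suc; _+_; _⊔_; _<_; _≰_; _≤?_; z≤n; s≤s)
open import Data.Nat.Induction using (<-wellFounded)
open import Data.Nat.Properties
  using ( ≤-trans; ≤-antisym; <-irrefl; +-suc; +-comm; +-cancelʳ-≡; +-cancelʳ-≤; +-monoʳ-≤; +-mono-≤; ≰⇒>
        ; ⊔-lub; m≤m⊔n; m≤n⊔m; ≡ᵇ⇒≡; ≡⇒≡ᵇ; module ≤-Reasoning )
open import Data.Product using (_×_; _,_; proj₁; proj₂; ∃; ∃₂; ∃-syntax)
import Data.Product as Product
open import Data.Sum using (_⊎_; inj₁; inj₂)
import Data.Sum as Sum
open import Data.Vec using (Vec; []; _∷_; zipWith; replicate; lookup; here; there)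
open import Data.Vec.Properties
  using ( []=⇒lookup; lookup⇒[]=; lookup∘tabulate
        ; zipWith-assoc; zipWith-comm; zipWith-identityˡ; zipWith-identityʳ; zipWith-distribʳ )
open import Function using (id; _∘_)
open import Function.Bundles using (Equivalence; _⇔_; mk⇔)
open import Induction.WellFounded using (Acc; acc)
open import Level using (0ℓ)
open import Relation.Binary.PropositionalEquality
  using (_≢_; refl; sym; trans; cong; cong₂; subst; subst₂; isEquivalence; module ≡-Reasoning)
open import Relation.Nullary using (yes; no; contradiction)
open import Relation.Nullary.Decidable using (_×-dec_)

variable
  k : ℕ
  x : Fin k
  p q r : Subset k

-- Addition in GF(2)^k; on subsets of Fin k it is symmetric difference.
infixl 6 _⊕_
_⊕_ : Vec Bool k → Vec Bool k → Vec Bool k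
_⊕_ = zipWith _xor_

zeros : Vec Bool k
zeros = replicate _ false

⊕-self : ∀ (u : Vec Bool k) → u ⊕ u ≡ zeros
⊕-self []      = refl
⊕-self (b ∷ u) = cong₂ _∷_ (xor-same b) (⊕-self u)

⊕-isAbelianGroup : ∀ k → IsAbelianGroup _≡_ (_⊕_ {k}) zeros id
⊕-isAbelianGroup k = record
  { isGroup = record
    { isMonoid = record
      { isSemigroup = record
        { isMagma = record { isEquivalence = isEquivalence ; ∙-cong = cong₂ _⊕_ }
        ; assoc   = zipWith-assoc xor-assoc
        }
      ; identity = zipWith-identityˡ xor-identityˡ , zipWith-identityʳ xor-identityʳ
      }
    ; inverse = ⊕-self , ⊕-self
    ; ⁻¹-cong = id
    }
  ; comm = zipWith-comm xor-comm
  }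

⊕-abelianGroup : ℕ → AbelianGroup 0ℓ 0ℓ
⊕-abelianGroup k = record { isAbelianGroup = ⊕-isAbelianGroup k }

module ⊕ {k : ℕ} where
  open AbelianGroup (⊕-abelianGroup k) public using (assoc; comm; identityˡ; identityʳ)
  open import Algebra.Properties.AbelianGroup (⊕-abelianGroup k) public using (inverseˡ-unique)
  open import Algebra.Properties.CommutativeSemigroup (AbelianGroup.commutativeSemigroup (⊕-abelianGroup k))
    public using (interchange; x∙yz≈y∙xz)

⊕-cancelˡ : ∀ (u v : Vec Bool k) → u ⊕ (u ⊕ v) ≡ v
⊕-cancelˡ u v = trans (sym (⊕.assoc u u v)) (trans (cong (_⊕ v) (⊕-self u)) (⊕.identityˡ v))

⊕-cancelʳ : ∀ (u v : Vec Bool k) → (u ⊕ v) ⊕ v ≡ u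
⊕-cancelʳ u v = trans (⊕.assoc u v v) (trans (cong (u ⊕_) (⊕-self v)) (⊕.identityʳ u))

⊕-distribʳ-∩ : ∀ (p q r : Subset k) → (p ⊕ q) ∩ r ≡ (p ∩ r) ⊕ (q ∩ r)
⊕-distribʳ-∩ p q r = zipWith-distribʳ ∧-distribʳ-xor r p q

x∈p⊕q⁻ : ∀ (p q : Subset k) → x ∈ p ⊕ q → (x ∈ p × x ∉ q) ⊎ (x ∉ p × x ∈ q)
x∈p⊕q⁻ (true  ∷ p) (false ∷ q) here       = inj₁ (here , λ ())
x∈p⊕q⁻ (false ∷ p) (true  ∷ q) here       = inj₂ ((λ ()) , here)
x∈p⊕q⁻ (_     ∷ p) (_     ∷ q) (there x∈) =
  Sum.map (Product.map there (_∘ drop-there)) (Product.map (_∘ drop-there) there) (x∈p⊕q⁻ p q x∈)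

x∈p⊕q⁺ : x ∈ p → x ∉ q → x ∈ p ⊕ q
x∈p⊕q⁺ {q = false ∷ _} here       _   = here
x∈p⊕q⁺ {q = true  ∷ _} here       x∉q = contradiction here x∉q
x∈p⊕q⁺ {q = _     ∷ _} (there x∈) x∉q = there (x∈p⊕q⁺ x∈ (x∉q ∘ there))

x∈p⊕q⁺ʳ : x ∉ p → x ∈ q → x ∈ p ⊕ q
x∈p⊕q⁺ʳ {p = p} {q = q} x∉p x∈q = subst (_ ∈_) (⊕.comm q p) (x∈p⊕q⁺ x∈q x∉p)

⊕-⊆ : p ⊆ r → q ⊆ r → p ⊕ q ⊆ r
⊕-⊆ {p = p} {q = q} p⊆r q⊆r x∈ with x∈p⊕q⁻ p q x∈
... | inj₁ (x∈p , _) = p⊆r x∈p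
... | inj₂ (_ , x∈q) = q⊆r x∈q

⊕-⊂ : q ⊆ p → Nonempty q → p ⊕ q ⊂ p
⊕-⊂ {q = q} {p = p} q⊆p (x , x∈q) = ⊕-⊆ ⊆-refl q⊆p , x , q⊆p x∈q , x∉p⊕q
  where
  x∉p⊕q : x ∉ p ⊕ q
  x∉p⊕q x∈ with x∈p⊕q⁻ p q x∈
  ... | inj₁ (_ , x∉q) = x∉q x∈q
  ... | inj₂ (x∉p , _) = x∉p (q⊆p x∈q)

∪-⊆ : p ⊆ r → q ⊆ r → p ∪ q ⊆ r
∪-⊆ {p = p} {q = q} p⊆r q⊆r x∈ with x∈p∪q⁻ p q x∈
... | inj₁ x∈p = p⊆r x∈p
... | inj₂ x∈q = q⊆r x∈q

x∈p⇒⁅x⁆⊆p : x ∈ p → ⁅ x ⁆ ⊆ p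
x∈p⇒⁅x⁆⊆p {x = x} {p = p} x∈p y∈⁅x⁆ = subst (_∈ p) (sym (x∈⁅y⁆⇒x≡y x y∈⁅x⁆)) x∈p

x∉p⇒p⊆q∪⁅x⁆⇒p⊆q : x ∉ p → p ⊆ q ∪ ⁅ x ⁆ → p ⊆ q
x∉p⇒p⊆q∪⁅x⁆⇒p⊆q {x = x} {p = p} {q = q} x∉p p⊆q∪x y∈p with x∈p∪q⁻ q ⁅ x ⁆ (p⊆q∪x y∈p)
... | inj₁ y∈q   = y∈q
... | inj₂ y∈⁅x⁆ = contradiction (subst (_∈ p) (x∈⁅y⁆⇒x≡y x y∈⁅x⁆) y∈p) x∉p

Empty-∩∁⇒⊆ : Empty (p ∩ ∁ q) → p ⊆ q
Empty-∩∁⇒⊆ {q = q} empty {x} x∈p with x ∈? q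
... | yes x∈q = x∈q
... | no  x∉q = contradiction (x , x∈p∩q⁺ (x∈p , x∉p⇒x∈∁p x∉q)) empty

p⊆q⇒p∩q≡p : p ⊆ q → p ∩ q ≡ p
p⊆q⇒p∩q≡p {p = p} {q = q} p⊆q = ⊆-antisym (p∩q⊆p p q) (λ x∈p → x∈p∩q⁺ (x∈p , p⊆q x∈p))

p⊆∁q⇒p∩q≡⊥ : p ⊆ ∁ q → p ∩ q ≡ ⊥
p⊆∁q⇒p∩q≡⊥ {p = p} {q = q} p⊆∁q = Empty-unique λ (x , x∈p∩q) →
  let (x∈p , x∈q) = x∈p∩q⁻ p q x∈p∩q in x∈∁p⇒x∉p (p⊆∁q x∈p) x∈q

p∩q⊕p∩∁q≡p : ∀ (p q : Subset k) → (p ∩ q) ⊕ (p ∩ ∁ q) ≡ p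
p∩q⊕p∩∁q≡p []          []          = refl
p∩q⊕p∩∁q≡p (true  ∷ p) (true  ∷ q) = cong (true ∷_) (p∩q⊕p∩∁q≡p p q)
p∩q⊕p∩∁q≡p (true  ∷ p) (false ∷ q) = cong (true ∷_) (p∩q⊕p∩∁q≡p p q)
p∩q⊕p∩∁q≡p (false ∷ p) (_     ∷ q) = cong (false ∷_) (p∩q⊕p∩∁q≡p p q)

p∪q─p∩q≡p⊕q : ∀ (p q : Subset k) → (p ∪ q) ─ (p ∩ q) ≡ p ⊕ q
p∪q─p∩q≡p⊕q []          []          = refl
p∪q─p∩q≡p⊕q (true  ∷ p) (true  ∷ q) = cong (false ∷_) (p∪q─p∩q≡p⊕q p q)
p∪q─p∩q≡p⊕q (true  ∷ p) (false ∷ q) = cong (true ∷_) (p∪q─p∩q≡p⊕q p q)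
p∪q─p∩q≡p⊕q (false ∷ p) (true  ∷ q) = cong (true ∷_) (p∪q─p∩q≡p⊕q p q)
p∪q─p∩q≡p⊕q (false ∷ p) (false ∷ q) = cong (false ∷_) (p∪q─p∩q≡p⊕q p q)

∣p∪q∣+∣p∩q∣≡∣p∣+∣q∣ : ∀ (p q : Subset k) → ∣ p ∪ q ∣ + ∣ p ∩ q ∣ ≡ ∣ p ∣ + ∣ q ∣
∣p∪q∣+∣p∩q∣≡∣p∣+∣q∣ []          []          = refl
∣p∪q∣+∣p∩q∣≡∣p∣+∣q∣ (true  ∷ p) (true  ∷ q) =
  cong suc (trans (+-suc _ _) (trans (cong suc (∣p∪q∣+∣p∩q∣≡∣p∣+∣q∣ p q)) (sym (+-suc _ _))))
∣p∪q∣+∣p∩q∣≡∣p∣+∣q∣ (true  ∷ p) (false ∷ q) = cong suc (∣p∪q∣+∣p∩q∣≡∣p∣+∣q∣ p q)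
∣p∪q∣+∣p∩q∣≡∣p∣+∣q∣ (false ∷ p) (true  ∷ q) = trans (cong suc (∣p∪q∣+∣p∩q∣≡∣p∣+∣q∣ p q)) (sym (+-suc _ _))
∣p∪q∣+∣p∩q∣≡∣p∣+∣q∣ (false ∷ p) (false ∷ q) = ∣p∪q∣+∣p∩q∣≡∣p∣+∣q∣ p q

∣p∩q∣+∣p∩∁q∣≡∣p∣ : ∀ (p q : Subset k) → ∣ p ∩ q ∣ + ∣ p ∩ ∁ q ∣ ≡ ∣ p ∣
∣p∩q∣+∣p∩∁q∣≡∣p∣ []          []          = refl
∣p∩q∣+∣p∩∁q∣≡∣p∣ (true  ∷ p) (true  ∷ q) = cong suc (∣p∩q∣+∣p∩∁q∣≡∣p∣ p q)
∣p∩q∣+∣p∩∁q∣≡∣p∣ (true  ∷ p) (false ∷ q) = trans (+-suc _ _) (cong suc (∣p∩q∣+∣p∩∁q∣≡∣p∣ p q))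
∣p∩q∣+∣p∩∁q∣≡∣p∣ (false ∷ p) (_     ∷ q) = ∣p∩q∣+∣p∩∁q∣≡∣p∣ p q

x∈p⇒1+∣p⊕⁅x⁆∣≡∣p∣ : x ∈ p → suc ∣ p ⊕ ⁅ x ⁆ ∣ ≡ ∣ p ∣
x∈p⇒1+∣p⊕⁅x⁆∣≡∣p∣ {p = true  ∷ p} here       = cong (suc ∘ ∣_∣) (⊕.identityʳ p)
x∈p⇒1+∣p⊕⁅x⁆∣≡∣p∣ {p = true  ∷ p} (there x∈) = cong suc (x∈p⇒1+∣p⊕⁅x⁆∣≡∣p∣ x∈)
x∈p⇒1+∣p⊕⁅x⁆∣≡∣p∣ {p = false ∷ p} (there x∈) = x∈p⇒1+∣p⊕⁅x⁆∣≡∣p∣ x∈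

x∉p⇒∣p⊕⁅x⁆∣≡1+∣p∣ : x ∉ p → ∣ p ⊕ ⁅ x ⁆ ∣ ≡ suc ∣ p ∣
x∉p⇒∣p⊕⁅x⁆∣≡1+∣p∣ {x = zero}  {p = true  ∷ p} x∉ = contradiction here x∉
x∉p⇒∣p⊕⁅x⁆∣≡1+∣p∣ {x = zero}  {p = false ∷ p} x∉ = cong (suc ∘ ∣_∣) (⊕.identityʳ p)
x∉p⇒∣p⊕⁅x⁆∣≡1+∣p∣ {x = suc x} {p = true  ∷ p} x∉ = cong suc (x∉p⇒∣p⊕⁅x⁆∣≡1+∣p∣ (x∉ ∘ there))
x∉p⇒∣p⊕⁅x⁆∣≡1+∣p∣ {x = suc x} {p = false ∷ p} x∉ = x∉p⇒∣p⊕⁅x⁆∣≡1+∣p∣ (x∉ ∘ there)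

x∈p⇒1+∣p-x∣≡∣p∣ : x ∈ p → suc ∣ p - x ∣ ≡ ∣ p ∣
x∈p⇒1+∣p-x∣≡∣p∣ {p = true  ∷ p} here       = cong (suc ∘ ∣_∣) (p─⊥≡p p)
x∈p⇒1+∣p-x∣≡∣p∣ {p = true  ∷ p} (there x∈) = cong suc (x∈p⇒1+∣p-x∣≡∣p∣ x∈)
x∈p⇒1+∣p-x∣≡∣p∣ {p = false ∷ p} (there x∈) = x∈p⇒1+∣p-x∣≡∣p∣ x∈

∣p∣≤1⇒p≡⁅x⁆ : ∣ p ∣ ≤ 1 → x ∈ p → p ≡ ⁅ x ⁆
∣p∣≤1⇒p≡⁅x⁆ {p = p} {x = x} ∣p∣≤1 x∈p = ⊆-antisym p⊆⁅x⁆ (x∈p⇒⁅x⁆⊆p x∈p)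
  where
  2≰∣p∣ : 2 ≰ ∣ p ∣
  2≰∣p∣ 2≤∣p∣ with ≤-trans 2≤∣p∣ ∣p∣≤1
  ... | s≤s ()
  p⊆⁅x⁆ : p ⊆ ⁅ x ⁆
  p⊆⁅x⁆ {y} y∈p with y ∈? ⁅ x ⁆
  ... | yes y∈⁅x⁆ = y∈⁅x⁆
  ... | no  y∉⁅x⁆ = contradiction (p⊂q⇒∣p∣<∣q∣ (x∈p⇒⁅x⁆⊆p x∈p , y , y∈p , y∉⁅x⁆))
                      (subst (λ c → suc c ≰ ∣ p ∣) (sym (∣⁅x⁆∣≡1 x)) 2≰∣p∣)

⊕-⁅⁆-induction : ∀ (P : Subset k → Set) → P ⊥ → (∀ {S T} → P S → P T → P (S ⊕ T)) →
                 ∀ p → (∀ {x} → x ∈ p → P ⁅ x ⁆) → P p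
⊕-⁅⁆-induction P P⊥ P⊕ []          _   = P⊥
⊕-⁅⁆-induction P P⊥ P⊕ (false ∷ p) P⁅⁆ = ⊕-⁅⁆-induction (P ∘ (false ∷_)) P⊥ P⊕ p (P⁅⁆ ∘ there)
⊕-⁅⁆-induction P P⊥ P⊕ (true  ∷ p) P⁅⁆ =
  subst (P ∘ (true ∷_)) (⊕.identityˡ p) (P⊕ (P⁅⁆ here) (⊕-⁅⁆-induction (P ∘ (false ∷_)) P⊥ P⊕ p (P⁅⁆ ∘ there)))

m+n≡o+2⇒3≤n⇒m<o : ∀ {m n o} → m + n ≡ o + 2 → 3 ≤ n → m < o
m+n≡o+2⇒3≤n⇒m<o {m} {n} {o} m+n≡o+2 3≤n = +-cancelʳ-≤ 2 (suc m) o (begin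
  suc m + 2   ≡⟨ +-suc m 2 ⟨
  m + 3       ≤⟨ +-monoʳ-≤ m 3≤n ⟩
  m + n       ≡⟨ m+n≡o+2 ⟩
  o + 2       ∎)
  where open ≤-Reasoning

module _ {m : ℕ} where

  sumSel-⊕ : ∀ (B : BinRep k m) (S T : Subset k) → sumSel B (S ⊕ T) ≡ sumSel B S ⊕ sumSel B T
  sumSel-⊕ []      []          []          = sym (⊕-self zeros)
  sumSel-⊕ (a ∷ B) (true  ∷ S) (true  ∷ T) = begin
    sumSel B (S ⊕ T)                      ≡⟨ sumSel-⊕ B S T ⟩
    sumSel B S ⊕ sumSel B T               ≡⟨ ⊕.identityˡ _ ⟨
    zeros ⊕ (sumSel B S ⊕ sumSel B T)     ≡⟨ cong (_⊕ _) (⊕-self a) ⟨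
    (a ⊕ a) ⊕ (sumSel B S ⊕ sumSel B T)   ≡⟨ ⊕.interchange a a _ _ ⟩
    (a ⊕ sumSel B S) ⊕ (a ⊕ sumSel B T)   ∎
    where open ≡-Reasoning
  sumSel-⊕ (a ∷ B) (true  ∷ S) (false ∷ T) = trans (cong (a ⊕_) (sumSel-⊕ B S T)) (sym (⊕.assoc a _ _))
  sumSel-⊕ (a ∷ B) (false ∷ S) (true  ∷ T) = trans (cong (a ⊕_) (sumSel-⊕ B S T)) (⊕.x∙yz≈y∙xz a _ _)
  sumSel-⊕ (a ∷ B) (false ∷ S) (false ∷ T) = sumSel-⊕ B S T

  sumSel-⊥ : ∀ (B : BinRep k m) → sumSel B ⊥ ≡ zeros
  sumSel-⊥ []      = refl
  sumSel-⊥ (_ ∷ B) = sumSel-⊥ B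

  sumSel-⁅⁆ : ∀ (B : BinRep k m) x → sumSel B ⁅ x ⁆ ≡ lookup B x
  sumSel-⁅⁆ (a ∷ B) zero    = trans (cong (a ⊕_) (sumSel-⊥ B)) (⊕.identityʳ a)
  sumSel-⁅⁆ (_ ∷ B) (suc x) = sumSel-⁅⁆ B x

⊆ᵇ⇒⊆ : ∀ (p q : Subset k) → T (p ⊆ᵇ q) → p ⊆ q
⊆ᵇ⇒⊆ (true ∷ p) (true ∷ q) _ here       = here
⊆ᵇ⇒⊆ (_    ∷ p) (_    ∷ q) h (there x∈) = there (⊆ᵇ⇒⊆ p q (proj₂ (Equivalence.to T-∧ h)) x∈)

⊆⇒⊆ᵇ : ∀ (p q : Subset k) → p ⊆ q → T (p ⊆ᵇ q)
⊆⇒⊆ᵇ []          []          _   = _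
⊆⇒⊆ᵇ (true  ∷ p) (true  ∷ q) p⊆q = ⊆⇒⊆ᵇ p q (drop-∷-⊆ p⊆q)
⊆⇒⊆ᵇ (true  ∷ p) (false ∷ q) p⊆q with p⊆q here
... | ()
⊆⇒⊆ᵇ (false ∷ p) (_     ∷ q) p⊆q = ⊆⇒⊆ᵇ p q (drop-∷-⊆ p⊆q)

nonemptyᵇ⇒Nonempty : ∀ (p : Subset k) → T (nonemptyᵇ p) → Nonempty p
nonemptyᵇ⇒Nonempty (true  ∷ p) _ = zero , here
nonemptyᵇ⇒Nonempty (false ∷ p) h = Product.map suc there (nonemptyᵇ⇒Nonempty p h)

Nonempty⇒nonemptyᵇ : ∀ (p : Subset k) → Nonempty p → T (nonemptyᵇ p)
Nonempty⇒nonemptyᵇ (true ∷ p) _                  = _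
Nonempty⇒nonemptyᵇ (b    ∷ p) (suc x , there x∈) =
  Equivalence.from (T-∨ {b}) (inj₂ (Nonempty⇒nonemptyᵇ p (x , x∈)))

isZero⇒≡zeros : ∀ (v : Vec Bool k) → T (isZero v) → v ≡ zeros
isZero⇒≡zeros []          _ = refl
isZero⇒≡zeros (false ∷ v) h = cong (false ∷_) (isZero⇒≡zeros v h)

isZero-zeros : ∀ k → T (isZero (zeros {k}))
isZero-zeros zero    = _
isZero-zeros (suc k) = isZero-zeros k

∈-allSubsets : ∀ (p : Subset k) → p List.∈ allSubsets k
∈-allSubsets []          = hereᴸ refl
∈-allSubsets (true  ∷ p) = ∈-++⁺ˡ (∈-map⁺ (true ∷_) (∈-allSubsets p))
∈-allSubsets (false ∷ p) = ∈-++⁺ʳ (List.map (true ∷_) (allSubsets _)) (∈-map⁺ (false ∷_) (∈-allSubsets p))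

T-any-allSubsets : ∀ (f : Subset k → Bool) → T (any f (allSubsets k)) ⇔ (∃[ p ] T (f p))
T-any-allSubsets f = mk⇔ (satisfied ∘ any⁻ f (allSubsets _))
  (λ (p , fp) → any⁺ {xs = allSubsets _} f (List.lose (∈-allSubsets p) fp))

module _ {A : Set} (f : A → ℕ) where

  foldr-⊔-≥ : ∀ {a xs} → a List.∈ xs → f a ≤ foldr (λ y acc → f y ⊔ acc) 0 xs
  foldr-⊔-≥ {xs = y ∷ _} (hereᴸ refl) = m≤m⊔n (f y) _
  foldr-⊔-≥ {xs = y ∷ _} (thereᴸ a∈)  = ≤-trans (foldr-⊔-≥ a∈) (m≤n⊔m (f y) _)

  foldr-⊔-≤ : ∀ {b} xs → (∀ a → f a ≤ b) → foldr (λ y acc → f y ⊔ acc) 0 xs ≤ b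
  foldr-⊔-≤ []       _ = z≤n
  foldr-⊔-≤ (y ∷ xs) h = ⊔-lub (h y) (foldr-⊔-≤ xs h)

module BinaryMatroid {n m} (A : BinRep n m) where

  ∑ : Subset n → Vec Bool m
  ∑ = sumSel A

  col : Fin n → Vec Bool m
  col = lookup A

  Cycle : Subset n → Set
  Cycle S = ∑ S ≡ zeros

  Indep : Subset n → Set
  Indep I = ∀ {S} → S ⊆ I → Cycle S → Empty S

  private
    variable
      B C D I J S W Z Z₀ Z₁ Z₂ : Subset n
      i j : Fin n
      v : Vec Bool m

    dependencyᵇ : Subset n → Subset n → Bool
    dependencyᵇ I S = (S ⊆ᵇ I) ∧ (nonemptyᵇ S ∧ isZero (∑ S))

    T-dependencyᵇ : T (dependencyᵇ I S) ⇔ (S ⊆ I × Nonempty S × Cycle S)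
    T-dependencyᵇ {I} {S} = mk⇔ decode encode
      where
      decode : T (dependencyᵇ I S) → S ⊆ I × Nonempty S × Cycle S
      decode h = let (S⊆ᵇI , h′) = Equivalence.to T-∧ h ; (ne , z) = Equivalence.to T-∧ h′ in
        ⊆ᵇ⇒⊆ S I S⊆ᵇI , nonemptyᵇ⇒Nonempty S ne , isZero⇒≡zeros (∑ S) z
      encode : S ⊆ I × Nonempty S × Cycle S → T (dependencyᵇ I S)
      encode (S⊆I , ne , cyc) = Equivalence.from T-∧ (⊆⇒⊆ᵇ S I S⊆I ,
        Equivalence.from T-∧ (Nonempty⇒nonemptyᵇ S ne , subst (T ∘ isZero) (sym cyc) (isZero-zeros m)))

  dependent⇒cycle : indepᵇ A I ≡ false → ∃[ S ] S ⊆ I × Nonempty S × Cycle S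
  dependent⇒cycle {I} h =
    let (S , d) = Equivalence.to (T-any-allSubsets (dependencyᵇ I)) (Equivalence.from T-≡ (not-injective h))
    in S , Equivalence.to T-dependencyᵇ d

  Independent⇒Indep : Independent A I → Indep I
  Independent⇒Indep {I} h {S} S⊆I cyc ne = contradiction (trans (sym h) (cong not any≡true)) λ ()
    where
    any≡true : any (dependencyᵇ I) (allSubsets n) ≡ true
    any≡true = Equivalence.to T-≡ (Equivalence.from (T-any-allSubsets (dependencyᵇ I))
                 (S , Equivalence.from (T-dependencyᵇ {I} {S}) (S⊆I , ne , cyc)))

  Indep⇒Independent : Indep I → Independent A I
  Indep⇒Independent {I} indI with indepᵇ A I in eq
  ... | true  = refl
  ... | false = let (S , S⊆I , ne , cyc) = dependent⇒cycle eq in ⊥-elim (indI S⊆I cyc ne)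

  Indep-⊆ : I ⊆ J → Indep J → Indep I
  Indep-⊆ I⊆J indJ S⊆I = indJ (I⊆J ∘ S⊆I)

  Indep-⊥ : Indep ⊥
  Indep-⊥ S⊆⊥ _ (x , x∈S) = ∉⊥ (S⊆⊥ x∈S)

  ∣I∣≤rank : I ⊆ Z → Indep I → ∣ I ∣ ≤ rank A Z
  ∣I∣≤rank {I} {Z} I⊆Z indI = subst (_≤ rank A Z) value (foldr-⊔-≥ _ (∈-allSubsets I))
    where
    value : (if (I ⊆ᵇ Z) ∧ indepᵇ A I then ∣ I ∣ else 0) ≡ ∣ I ∣
    value rewrite Equivalence.to T-≡ (⊆⇒⊆ᵇ I Z I⊆Z) | Indep⇒Independent indI = refl

  rank≤ : ∀ {b} → (∀ {I} → I ⊆ Z → Indep I → ∣ I ∣ ≤ b) → rank A Z ≤ b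
  rank≤ {Z} bound = foldr-⊔-≤ _ (allSubsets n) value≤
    where
    value≤ : ∀ I → (if (I ⊆ᵇ Z) ∧ indepᵇ A I then ∣ I ∣ else 0) ≤ _
    value≤ I with I ⊆ᵇ Z in I⊆ᵇZ | indepᵇ A I in indI
    ... | true  | true  = bound (⊆ᵇ⇒⊆ I Z (Equivalence.from T-≡ I⊆ᵇZ)) (Independent⇒Indep indI)
    ... | true  | false = z≤n
    ... | false | _     = z≤n

  infix 4 _∈⟨_⟩ _⊆⟨_⟩

  _∈⟨_⟩ : Vec Bool m → Subset n → Set
  v ∈⟨ Z ⟩ = ∃[ S ] S ⊆ Z × ∑ S ≡ v

  _⊆⟨_⟩ : Subset n → Subset n → Set
  W ⊆⟨ Z ⟩ = ∀ {x} → x ∈ W → col x ∈⟨ Z ⟩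

  ∑-⊕ : ∀ S T → ∑ (S ⊕ T) ≡ ∑ S ⊕ ∑ T
  ∑-⊕ = sumSel-⊕ A

  ⊕∈⟨⟩ : ∀ {u} → u ∈⟨ Z ⟩ → v ∈⟨ Z ⟩ → u ⊕ v ∈⟨ Z ⟩
  ⊕∈⟨⟩ (S , S⊆Z , refl) (T , T⊆Z , refl) = S ⊕ T , ⊕-⊆ S⊆Z T⊆Z , ∑-⊕ S T

  ∈⟨⟩-mono : W ⊆ Z → v ∈⟨ W ⟩ → v ∈⟨ Z ⟩
  ∈⟨⟩-mono W⊆Z (S , S⊆W , ∑S≡v) = S , W⊆Z ∘ S⊆W , ∑S≡v

  ⊆⇒⊆⟨⟩ : W ⊆ Z → W ⊆⟨ Z ⟩
  ⊆⇒⊆⟨⟩ W⊆Z {x} x∈W = ⁅ x ⁆ , x∈p⇒⁅x⁆⊆p (W⊆Z x∈W) , sumSel-⁅⁆ A x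

  col∈⟨⟩ : x ∈ Z → col x ∈⟨ Z ⟩
  col∈⟨⟩ = ⊆⇒⊆⟨⟩ ⊆-refl

  ⊆⟨⟩-mono : Z₁ ⊆ Z₂ → W ⊆⟨ Z₁ ⟩ → W ⊆⟨ Z₂ ⟩
  ⊆⟨⟩-mono Z₁⊆Z₂ W⊆⟨Z₁⟩ = ∈⟨⟩-mono Z₁⊆Z₂ ∘ W⊆⟨Z₁⟩

  ∈⟨⟩-trans : W ⊆⟨ Z ⟩ → v ∈⟨ W ⟩ → v ∈⟨ Z ⟩
  ∈⟨⟩-trans {W} {Z} W⊆⟨Z⟩ (S , S⊆W , refl) = ⊕-⁅⁆-induction (λ T → ∑ T ∈⟨ Z ⟩) (⊥ , ⊥⊆ , refl)
    (λ {T} {T′} ∑T∈ ∑T′∈ → subst (_∈⟨ Z ⟩) (sym (∑-⊕ T T′)) (⊕∈⟨⟩ ∑T∈ ∑T′∈)) S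
    (λ {x} x∈S → subst (_∈⟨ Z ⟩) (sym (sumSel-⁅⁆ A x)) (W⊆⟨Z⟩ (S⊆W x∈S)))

  ⊆⟨⟩-trans : I ⊆⟨ W ⟩ → W ⊆⟨ Z ⟩ → I ⊆⟨ Z ⟩
  ⊆⟨⟩-trans I⊆⟨W⟩ W⊆⟨Z⟩ = ∈⟨⟩-trans W⊆⟨Z⟩ ∘ I⊆⟨W⟩

  ∪-⊆⟨⟩ : I ⊆⟨ Z ⟩ → W ⊆⟨ Z ⟩ → I ∪ W ⊆⟨ Z ⟩
  ∪-⊆⟨⟩ {I} {W = W} I⊆⟨Z⟩ W⊆⟨Z⟩ x∈ with x∈p∪q⁻ I W x∈
  ... | inj₁ x∈I = I⊆⟨Z⟩ x∈I
  ... | inj₂ x∈W = W⊆⟨Z⟩ x∈W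

  ⁅⁆-⊆⟨⟩ : col x ∈⟨ Z ⟩ → ⁅ x ⁆ ⊆⟨ Z ⟩
  ⁅⁆-⊆⟨⟩ {x} {Z} x∈⟨Z⟩ y∈⁅x⁆ = subst (λ y → col y ∈⟨ Z ⟩) (sym (x∈⁅y⁆⇒x≡y x y∈⁅x⁆)) x∈⟨Z⟩

  Indep-∪⁅⁆⊎∈⟨⟩ : Indep J → Indep (J ∪ ⁅ x ⁆) ⊎ col x ∈⟨ J ⟩
  Indep-∪⁅⁆⊎∈⟨⟩ {J} {x} indJ with indepᵇ A (J ∪ ⁅ x ⁆) in eq
  ... | true  = inj₁ (Independent⇒Indep eq)
  ... | false with dependent⇒cycle eq
  ...   | S , S⊆J∪x , ne , cyc with x ∈? S
  ...     | no  x∉S = ⊥-elim (indJ (x∉p⇒p⊆q∪⁅x⁆⇒p⊆q x∉S S⊆J∪x) cyc ne)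
  ...     | yes x∈S = inj₂ (S ⊕ ⁅ x ⁆ , x∉p⇒p⊆q∪⁅x⁆⇒p⊆q x∉S⊕x (S⊆J∪x ∘ S⊕x⊆S) , ∑S⊕x≡colx)
    where
    S⊕x⊆S : S ⊕ ⁅ x ⁆ ⊆ S
    S⊕x⊆S = ⊕-⊆ ⊆-refl (x∈p⇒⁅x⁆⊆p x∈S)
    x∉S⊕x : x ∉ S ⊕ ⁅ x ⁆
    x∉S⊕x x∈ with x∈p⊕q⁻ S ⁅ x ⁆ x∈
    ... | inj₁ (_ , x∉⁅x⁆) = x∉⁅x⁆ (x∈⁅x⁆ x)
    ... | inj₂ (x∉S , _)   = x∉S x∈S
    ∑S⊕x≡colx : ∑ (S ⊕ ⁅ x ⁆) ≡ col x
    ∑S⊕x≡colx = trans (∑-⊕ S ⁅ x ⁆) (trans (cong₂ _⊕_ cyc (sumSel-⁅⁆ A x)) (⊕.identityˡ (col x)))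

  exchange : S ⊆ I → i ∈ S → j ∉ I → ∑ S ≡ col j →
             let I′ = I ⊕ ⁅ i ⁆ ⊕ ⁅ j ⁆ in
             ∣ I′ ∣ ≡ ∣ I ∣ × I ⊆⟨ I′ ⟩ × j ∈ I′ × (∀ {y} → y ∈ I → y ≢ i → y ∈ I′)
  exchange {S} {I} {i} {j} S⊆I i∈S j∉I ∑S≡colj = ∣I′∣≡∣I∣ , I⊆⟨I′⟩ , j∈I′ , keep
    where
    I′ : Subset n
    I′ = I ⊕ ⁅ i ⁆ ⊕ ⁅ j ⁆
    j∉I⊕i : j ∉ I ⊕ ⁅ i ⁆
    j∉I⊕i j∈ with x∈p⊕q⁻ I ⁅ i ⁆ j∈
    ... | inj₁ (j∈I , _)   = j∉I j∈I
    ... | inj₂ (_ , j∈⁅i⁆) = j∉I (x∈p⇒⁅x⁆⊆p (S⊆I i∈S) j∈⁅i⁆)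
    j∈I′ : j ∈ I′
    j∈I′ = x∈p⊕q⁺ʳ j∉I⊕i (x∈⁅x⁆ j)
    keep : ∀ {y} → y ∈ I → y ≢ i → y ∈ I′
    keep y∈I y≢i = x∈p⊕q⁺ (x∈p⊕q⁺ y∈I (x≢y⇒x∉⁅y⁆ y≢i)) (λ y∈⁅j⁆ → j∉I (subst (_∈ I) (x∈⁅y⁆⇒x≡y j y∈⁅j⁆) y∈I))
    ∣I′∣≡∣I∣ : ∣ I′ ∣ ≡ ∣ I ∣
    ∣I′∣≡∣I∣ = trans (x∉p⇒∣p⊕⁅x⁆∣≡1+∣p∣ j∉I⊕i) (x∈p⇒1+∣p⊕⁅x⁆∣≡∣p∣ (S⊆I i∈S))
    S⊕i⊆I′ : S ⊕ ⁅ i ⁆ ⊆ I′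
    S⊕i⊆I′ y∈ with x∈p⊕q⁻ S ⁅ i ⁆ y∈
    ... | inj₁ (y∈S , y∉⁅i⁆) = keep (S⊆I y∈S) (λ { refl → y∉⁅i⁆ (x∈⁅x⁆ i) })
    ... | inj₂ (y∉S , y∈⁅i⁆) = contradiction (x∈p⇒⁅x⁆⊆p i∈S y∈⁅i⁆) y∉S
    colj⊕∑S⊕i≡coli : col j ⊕ ∑ (S ⊕ ⁅ i ⁆) ≡ col i
    colj⊕∑S⊕i≡coli = begin
      col j ⊕ ∑ (S ⊕ ⁅ i ⁆)   ≡⟨ cong₂ _⊕_ (sym ∑S≡colj) (trans (∑-⊕ S ⁅ i ⁆) (cong (∑ S ⊕_) (sumSel-⁅⁆ A i))) ⟩
      ∑ S ⊕ (∑ S ⊕ col i)     ≡⟨ ⊕-cancelˡ (∑ S) (col i) ⟩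
      col i                   ∎
      where open ≡-Reasoning
    I⊆⟨I′⟩ : I ⊆⟨ I′ ⟩
    I⊆⟨I′⟩ {y} y∈I with y ≟ i
    ... | no  y≢i  = col∈⟨⟩ (keep y∈I y≢i)
    ... | yes refl = subst (_∈⟨ I′ ⟩) colj⊕∑S⊕i≡coli (⊕∈⟨⟩ (col∈⟨⟩ j∈I′) (S ⊕ ⁅ i ⁆ , S⊕i⊆I′ , refl))

  steinitz : Indep J → J ⊆⟨ I ⟩ → ∣ J ∣ ≤ ∣ I ∣
  steinitz {J} indJ = go (<-wellFounded _)
    where
    go : ∀ {I} → Acc _<_ ∣ J ∩ ∁ I ∣ → J ⊆⟨ I ⟩ → ∣ J ∣ ≤ ∣ I ∣
    go {I} (acc rec) J⊆⟨I⟩ with nonempty? (J ∩ ∁ I)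
    ... | no  J∖I-empty = p⊆q⇒∣p∣≤∣q∣ (Empty-∩∁⇒⊆ J∖I-empty)
    ... | yes (j , j∈J∖I) with x∈p∩q⁻ J (∁ I) j∈J∖I
    ...   | j∈J , j∈∁I with J⊆⟨I⟩ j∈J
    ...     | S , S⊆I , ∑S≡colj with nonempty? (S ∩ ∁ J)
    ...       | no S∖J-empty =
      ⊥-elim (indJ (⊕-⊆ (Empty-∩∁⇒⊆ S∖J-empty) (x∈p⇒⁅x⁆⊆p j∈J)) S⊕j-cycle (j , x∈p⊕q⁺ʳ j∉S (x∈⁅x⁆ j)))
      where
      j∉S : j ∉ S
      j∉S = x∈∁p⇒x∉p j∈∁I ∘ S⊆I
      S⊕j-cycle : Cycle (S ⊕ ⁅ j ⁆)
      S⊕j-cycle = trans (∑-⊕ S ⁅ j ⁆) (trans (cong₂ _⊕_ ∑S≡colj (sumSel-⁅⁆ A j)) (⊕-self (col j)))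
    ...       | yes (i , i∈S∖J) with x∈p∩q⁻ S (∁ J) i∈S∖J
    ...         | i∈S , i∈∁J with exchange S⊆I i∈S (x∈∁p⇒x∉p j∈∁I) ∑S≡colj
    ...           | ∣I′∣≡∣I∣ , I⊆⟨I′⟩ , j∈I′ , keep =
      subst (∣ J ∣ ≤_) ∣I′∣≡∣I∣ (go (rec (p⊂q⇒∣p∣<∣q∣ J∖I′⊂J∖I)) (⊆⟨⟩-trans J⊆⟨I⟩ I⊆⟨I′⟩))
      where
      J∖I′⊆J∖I : J ∩ ∁ (I ⊕ ⁅ i ⁆ ⊕ ⁅ j ⁆) ⊆ J ∩ ∁ I
      J∖I′⊆J∖I y∈ with x∈p∩q⁻ J _ y∈
      ... | y∈J , y∈∁I′ = x∈p∩q⁺ (y∈J , x∉p⇒x∈∁p λ y∈I →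
            x∈∁p⇒x∉p y∈∁I′ (keep y∈I λ { refl → x∈∁p⇒x∉p i∈∁J y∈J }))
      J∖I′⊂J∖I : J ∩ ∁ (I ⊕ ⁅ i ⁆ ⊕ ⁅ j ⁆) ⊂ J ∩ ∁ I
      J∖I′⊂J∖I = J∖I′⊆J∖I , j , j∈J∖I , λ j∈J∖I′ → x∈∁p⇒x∉p (proj₂ (x∈p∩q⁻ J _ j∈J∖I′)) j∈I′

  IsBasis : Subset n → Subset n → Set
  IsBasis Z B = B ⊆ Z × Indep B × Z ⊆⟨ B ⟩

  private
    grow-by : ∀ x → J ⊆ Z → Indep J → ∃[ J′ ] J ⊆ J′ × J′ ⊆ Z × Indep J′ × (x ∈ Z → col x ∈⟨ J′ ⟩)
    grow-by {J} {Z} x J⊆Z indJ with x ∈? Z | Indep-∪⁅⁆⊎∈⟨⟩ {x = x} indJ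
    ... | yes x∈Z | inj₁ indJ∪x = J ∪ ⁅ x ⁆ , p⊆p∪q ⁅ x ⁆ , ∪-⊆ J⊆Z (x∈p⇒⁅x⁆⊆p x∈Z) , indJ∪x ,
                                    λ _ → col∈⟨⟩ (q⊆p∪q J ⁅ x ⁆ (x∈⁅x⁆ x))
    ... | no  x∉Z | _           = J , ⊆-refl , J⊆Z , indJ , λ x∈Z → contradiction x∈Z x∉Z
    ... | _       | inj₂ x∈⟨J⟩  = J , ⊆-refl , J⊆Z , indJ , λ _ → x∈⟨J⟩

    grow : ∀ xs → J ⊆ Z → Indep J →
           ∃[ B ] J ⊆ B × B ⊆ Z × Indep B × (∀ {x} → x List.∈ xs → x ∈ Z → col x ∈⟨ B ⟩)
    grow {J} []       J⊆Z indJ = J , ⊆-refl , J⊆Z , indJ , λ ()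
    grow     (x ∷ xs) J⊆Z indJ with grow-by x J⊆Z indJ
    ... | J′ , J⊆J′ , J′⊆Z , indJ′ , x-spanned with grow xs J′⊆Z indJ′
    ... | B , J′⊆B , B⊆Z , indB , xs-spanned = B , J′⊆B ∘ J⊆J′ , B⊆Z , indB , spanned
      where
      spanned : ∀ {y} → y List.∈ x ∷ xs → y ∈ _ → col y ∈⟨ B ⟩
      spanned (hereᴸ refl)  y∈Z = ∈⟨⟩-mono J′⊆B (x-spanned y∈Z)
      spanned (thereᴸ y∈xs) y∈Z = xs-spanned y∈xs y∈Z

  extend-to-basis : I ⊆ Z → Indep I → ∃[ B ] I ⊆ B × IsBasis Z B
  extend-to-basis I⊆Z indI with grow (allFin n) I⊆Z indI
  ... | B , I⊆B , B⊆Z , indB , spanned = B , I⊆B , B⊆Z , indB , λ {x} → spanned (∈-allFin x)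

  basis : ∀ Z → ∃ (IsBasis Z)
  basis Z = let (B , _ , isBasis) = extend-to-basis ⊥⊆ Indep-⊥ in B , isBasis

  extend-within-span : Indep I → I ⊆⟨ Z ⟩ → ∃[ B ] I ⊆ B × Indep B × B ⊆⟨ Z ⟩ × Z ⊆⟨ B ⟩
  extend-within-span {I} {Z} indI I⊆⟨Z⟩ with extend-to-basis (q⊆p∪q Z I) indI
  ... | B , I⊆B , B⊆Z∪I , indB , Z∪I⊆⟨B⟩ =
    B , I⊆B , indB , ⊆⟨⟩-trans (⊆⇒⊆⟨⟩ B⊆Z∪I) (∪-⊆⟨⟩ col∈⟨⟩ I⊆⟨Z⟩) , Z∪I⊆⟨B⟩ ∘ p⊆p∪q I

  rank≡∣B∣ : Indep B → B ⊆⟨ Z ⟩ → Z ⊆⟨ B ⟩ → rank A Z ≡ ∣ B ∣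
  rank≡∣B∣ {B} {Z} indB B⊆⟨Z⟩ Z⊆⟨B⟩ = ≤-antisym
    (rank≤ λ I⊆Z indI → steinitz indI (Z⊆⟨B⟩ ∘ I⊆Z))
    (let (B′ , B′⊆Z , indB′ , Z⊆⟨B′⟩) = basis Z in
     ≤-trans (steinitz indB (⊆⟨⟩-trans B⊆⟨Z⟩ Z⊆⟨B′⟩)) (∣I∣≤rank B′⊆Z indB′))

  IsBasis⇒rank≡∣B∣ : IsBasis Z B → rank A Z ≡ ∣ B ∣
  IsBasis⇒rank≡∣B∣ (B⊆Z , indB , Z⊆⟨B⟩) = rank≡∣B∣ indB (⊆⇒⊆⟨⟩ B⊆Z) Z⊆⟨B⟩

  ∈cl⇔rank : x ∈ cl A Z ⇔ rank A (Z ∪ ⁅ x ⁆) ≡ rank A Z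
  ∈cl⇔rank {x} {Z} = mk⇔
    (λ x∈cl → ≡ᵇ⇒≡ _ _ (Equivalence.from T-≡ (trans (sym (lookup∘tabulate _ x)) ([]=⇒lookup x∈cl))))
    (λ r≡ → lookup⇒[]= x (cl A Z) (trans (lookup∘tabulate _ x) (Equivalence.to T-≡ (≡⇒≡ᵇ _ _ r≡))))

  ∈cl⇔∈⟨⟩ : x ∈ cl A Z ⇔ col x ∈⟨ Z ⟩
  ∈cl⇔∈⟨⟩ {x} {Z} with basis Z
  ... | B , isBasis@(B⊆Z , indB , Z⊆⟨B⟩) = mk⇔ to from
    where
    rZ≡∣B∣ : rank A Z ≡ ∣ B ∣
    rZ≡∣B∣ = IsBasis⇒rank≡∣B∣ isBasis
    B⊆Z∪x : B ⊆ Z ∪ ⁅ x ⁆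
    B⊆Z∪x = p⊆p∪q ⁅ x ⁆ ∘ B⊆Z
    from : col x ∈⟨ Z ⟩ → x ∈ cl A Z
    from x∈⟨Z⟩ = Equivalence.from ∈cl⇔rank (trans
      (rank≡∣B∣ indB (⊆⇒⊆⟨⟩ B⊆Z∪x) (∪-⊆⟨⟩ Z⊆⟨B⟩ (⁅⁆-⊆⟨⟩ (∈⟨⟩-trans Z⊆⟨B⟩ x∈⟨Z⟩))))
      (sym rZ≡∣B∣))
    to : x ∈ cl A Z → col x ∈⟨ Z ⟩
    to x∈cl with Indep-∪⁅⁆⊎∈⟨⟩ {x = x} indB
    ... | inj₂ x∈⟨B⟩ = ∈⟨⟩-mono B⊆Z x∈⟨B⟩
    ... | inj₁ indB∪x with x ∈? B
    ...   | yes x∈B = col∈⟨⟩ (B⊆Z x∈B)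
    ...   | no  x∉B = contradiction ∣B∣<∣B∣ (<-irrefl refl)
      where
      open ≤-Reasoning
      ∣B∣<∣B∣ : ∣ B ∣ < ∣ B ∣
      ∣B∣<∣B∣ = begin-strict
        ∣ B ∣                  <⟨ p⊂q⇒∣p∣<∣q∣ (p⊆p∪q ⁅ x ⁆ , x , q⊆p∪q B ⁅ x ⁆ (x∈⁅x⁆ x) , x∉B) ⟩
        ∣ B ∪ ⁅ x ⁆ ∣          ≤⟨ ∣I∣≤rank (∪-⊆ B⊆Z∪x (q⊆p∪q Z ⁅ x ⁆)) indB∪x ⟩
        rank A (Z ∪ ⁅ x ⁆)     ≡⟨ Equivalence.to ∈cl⇔rank x∈cl ⟩
        rank A Z               ≡⟨ rZ≡∣B∣ ⟩
        ∣ B ∣                  ∎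

  cl⊆⟨⟩ : cl A Z ⊆⟨ Z ⟩
  cl⊆⟨⟩ = Equivalence.to ∈cl⇔∈⟨⟩

  Indep-∪ : Indep I → Indep J → (∀ {v} → v ∈⟨ I ⟩ → v ∈⟨ J ⟩ → v ∈⟨ I ∩ J ⟩) → Indep (I ∪ J)
  Indep-∪ {I} {J} indI indJ meet {S} S⊆I∪J cyc = indJ S⊆J cyc
    where
    S∖J : Subset n
    S∖J = S ⊕ (S ∩ J)
    S∖J⁻ : ∀ {x} → x ∈ S∖J → x ∈ S × x ∉ J
    S∖J⁻ {x} x∈ with x∈p⊕q⁻ S (S ∩ J) x∈
    ... | inj₁ (x∈S , x∉S∩J) = x∈S , λ x∈J → x∉S∩J (x∈p∩q⁺ (x∈S , x∈J))
    ... | inj₂ (x∉S , x∈S∩J) = contradiction (p∩q⊆p S J x∈S∩J) x∉S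
    S∖J⊆I : S∖J ⊆ I
    S∖J⊆I x∈ with S∖J⁻ x∈
    ... | x∈S , x∉J with x∈p∪q⁻ I J (S⊆I∪J x∈S)
    ...   | inj₁ x∈I = x∈I
    ...   | inj₂ x∈J = contradiction x∈J x∉J
    ∑S∖J≡∑S∩J : ∑ S∖J ≡ ∑ (S ∩ J)
    ∑S∖J≡∑S∩J = trans (∑-⊕ S (S ∩ J)) (trans (cong (_⊕ ∑ (S ∩ J)) cyc) (⊕.identityˡ _))
    S⊆J : S ⊆ J
    S⊆J {x} x∈S with x ∈? J | meet (S∖J , S∖J⊆I , refl) (S ∩ J , p∩q⊆q S J , sym ∑S∖J≡∑S∩J)
    ... | yes x∈J | _ = x∈J
    ... | no  x∉J | R , R⊆I∩J , ∑R≡∑S∖J with x ∈? R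
    ...   | yes x∈R = contradiction (p∩q⊆q I J (R⊆I∩J x∈R)) x∉J
    ...   | no  x∉R = ⊥-elim (indI (⊕-⊆ S∖J⊆I (p∩q⊆p I J ∘ R⊆I∩J)) S∖J⊕R-cycle
                        (x , x∈p⊕q⁺ (x∈p⊕q⁺ x∈S (x∉J ∘ p∩q⊆q S J)) x∉R))
      where
      S∖J⊕R-cycle : Cycle (S∖J ⊕ R)
      S∖J⊕R-cycle = trans (∑-⊕ S∖J R) (trans (cong (∑ S∖J ⊕_) ∑R≡∑S∖J) (⊕-self _))

  rank-modular : Z₀ ⊆⟨ Z₁ ⟩ → Z₀ ⊆⟨ Z₂ ⟩ → (∀ {v} → v ∈⟨ Z₁ ⟩ → v ∈⟨ Z₂ ⟩ → v ∈⟨ Z₀ ⟩) →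
                 rank A Z₀ + rank A (Z₁ ∪ Z₂) ≡ rank A Z₁ + rank A Z₂
  rank-modular {Z₀} {Z₁} {Z₂} Z₀⊆⟨Z₁⟩ Z₀⊆⟨Z₂⟩ meet with basis Z₀
  ... | B₀ , isBasis₀@(B₀⊆Z₀ , indB₀ , Z₀⊆⟨B₀⟩)
      with extend-within-span indB₀ (Z₀⊆⟨Z₁⟩ ∘ B₀⊆Z₀) | extend-within-span indB₀ (Z₀⊆⟨Z₂⟩ ∘ B₀⊆Z₀)
  ... | B₁ , B₀⊆B₁ , indB₁ , B₁⊆⟨Z₁⟩ , Z₁⊆⟨B₁⟩ | B₂ , B₀⊆B₂ , indB₂ , B₂⊆⟨Z₂⟩ , Z₂⊆⟨B₂⟩ = begin
    rank A Z₀ + rank A (Z₁ ∪ Z₂)   ≡⟨ cong₂ _+_ (IsBasis⇒rank≡∣B∣ isBasis₀) rank-Z₁∪Z₂ ⟩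
    ∣ B₀ ∣ + ∣ B₁ ∪ B₂ ∣           ≡⟨ cong (_+ ∣ B₁ ∪ B₂ ∣) ∣B₁∩B₂∣≡∣B₀∣ ⟨
    ∣ B₁ ∩ B₂ ∣ + ∣ B₁ ∪ B₂ ∣      ≡⟨ +-comm ∣ B₁ ∩ B₂ ∣ _ ⟩
    ∣ B₁ ∪ B₂ ∣ + ∣ B₁ ∩ B₂ ∣      ≡⟨ ∣p∪q∣+∣p∩q∣≡∣p∣+∣q∣ B₁ B₂ ⟩
    ∣ B₁ ∣ + ∣ B₂ ∣                ≡⟨ cong₂ _+_ (rank≡∣B∣ indB₁ B₁⊆⟨Z₁⟩ Z₁⊆⟨B₁⟩) (rank≡∣B∣ indB₂ B₂⊆⟨Z₂⟩ Z₂⊆⟨B₂⟩) ⟨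
    rank A Z₁ + rank A Z₂          ∎
    where
    open ≡-Reasoning
    B₀⊆B₁∩B₂ : B₀ ⊆ B₁ ∩ B₂
    B₀⊆B₁∩B₂ x∈B₀ = x∈p∩q⁺ (B₀⊆B₁ x∈B₀ , B₀⊆B₂ x∈B₀)
    meet-B : ∀ {v} → v ∈⟨ B₁ ⟩ → v ∈⟨ B₂ ⟩ → v ∈⟨ B₀ ⟩
    meet-B v∈⟨B₁⟩ v∈⟨B₂⟩ = ∈⟨⟩-trans Z₀⊆⟨B₀⟩ (meet (∈⟨⟩-trans B₁⊆⟨Z₁⟩ v∈⟨B₁⟩) (∈⟨⟩-trans B₂⊆⟨Z₂⟩ v∈⟨B₂⟩))
    ∣B₁∩B₂∣≡∣B₀∣ : ∣ B₁ ∩ B₂ ∣ ≡ ∣ B₀ ∣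
    ∣B₁∩B₂∣≡∣B₀∣ = ≤-antisym
      (steinitz (Indep-⊆ (p∩q⊆p B₁ B₂) indB₁)
        (λ x∈ → meet-B (col∈⟨⟩ (p∩q⊆p B₁ B₂ x∈)) (col∈⟨⟩ (p∩q⊆q B₁ B₂ x∈))))
      (p⊆q⇒∣p∣≤∣q∣ B₀⊆B₁∩B₂)
    rank-Z₁∪Z₂ : rank A (Z₁ ∪ Z₂) ≡ ∣ B₁ ∪ B₂ ∣
    rank-Z₁∪Z₂ = rank≡∣B∣
      (Indep-∪ indB₁ indB₂ λ v₁ v₂ → ∈⟨⟩-mono B₀⊆B₁∩B₂ (meet-B v₁ v₂))
      (∪-⊆⟨⟩ (⊆⟨⟩-mono (p⊆p∪q Z₂) B₁⊆⟨Z₁⟩) (⊆⟨⟩-mono (q⊆p∪q Z₁ Z₂) B₂⊆⟨Z₂⟩))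
      (∪-⊆⟨⟩ (⊆⟨⟩-mono (p⊆p∪q B₂) Z₁⊆⟨B₁⟩) (⊆⟨⟩-mono (q⊆p∪q B₁ B₂) Z₂⊆⟨B₂⟩))

  Circuit⇒Cycle : Circuit A C → Cycle C
  Circuit⇒Cycle {C} (dep , minimal) with dependent⇒cycle dep
  ... | S , S⊆C , ne , cyc = subst Cycle (⊆-antisym S⊆C C⊆S) cyc
    where
    C⊆S : C ⊆ S
    C⊆S {x} x∈C with x ∈? S
    ... | yes x∈S = x∈S
    ... | no  x∉S = ⊥-elim (Independent⇒Indep (minimal S (S⊆C , x , x∈C , x∉S)) ⊆-refl cyc ne)

  cycle-induction : ∀ (P : Subset n → Set) → P ⊥ → (∀ {S T} → P S → P T → P (S ⊕ T)) →
                    (∀ {C} → Circuit A C → (∀ {S} → Cycle S → ∣ S ∣ < ∣ C ∣ → P S) → P C) →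
                    Cycle S → P S
  cycle-induction P P⊥ P⊕ P-circuit = go (<-wellFounded _)
    where
    go : ∀ {S} → Acc _<_ ∣ S ∣ → Cycle S → P S
    go {S} (acc rec) cyc with nonempty? S
    ... | no  S-empty = subst P (sym (Empty-unique S-empty)) P⊥
    ... | yes S-ne with anySubset? (λ R → R ⊂? S ×-dec indepᵇ A R ≟ᵇ false)
    ...   | no  no-dependent-proper-subset = P-circuit (S-dep , minimal) λ cyc′ lt → go (rec lt) cyc′
      where
      S-dep : indepᵇ A S ≡ false
      S-dep with indepᵇ A S in eq
      ... | true  = ⊥-elim (Independent⇒Indep eq ⊆-refl cyc S-ne)
      ... | false = refl
      minimal : ∀ R → R ⊂ S → Independent A R
      minimal R R⊂S with indepᵇ A R in eq
      ... | true  = refl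
      ... | false = ⊥-elim (no-dependent-proper-subset (R , R⊂S , eq))
    ...   | yes (R , R⊂S , R-dep) with dependent⇒cycle R-dep
    ...     | Q , Q⊆R , Q-ne , Q-cycle =
      subst P (⊕-cancelʳ S Q) (P⊕ (go (rec (p⊂q⇒∣p∣<∣q∣ S⊕Q⊂S)) S⊕Q-cycle) (go (rec (p⊂q⇒∣p∣<∣q∣ Q⊂S)) Q-cycle))
      where
      Q⊂S : Q ⊂ S
      Q⊂S = ⊆-⊂-trans Q⊆R R⊂S
      S⊕Q⊂S : S ⊕ Q ⊂ S
      S⊕Q⊂S = ⊕-⊂ (proj₁ Q⊂S) Q-ne
      S⊕Q-cycle : Cycle (S ⊕ Q)
      S⊕Q-cycle = trans (∑-⊕ S Q) (trans (cong₂ _⊕_ cyc Q-cycle) (⊕-self zeros))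

  chordal-split : Chordal A → Circuit A D → 4 ≤ ∣ D ∣ →
    ∃₂ λ D₁ D₂ → Circuit A D₁ × Circuit A D₂ × D ≡ D₁ ⊕ D₂ × ∣ D₁ ∣ + ∣ D₂ ∣ ≡ ∣ D ∣ + 2
  chordal-split {D} chordal D-circuit 4≤∣D∣ with chordal D D-circuit 4≤∣D∣
  ... | D₁ , D₂ , e , D₁-circuit , D₂-circuit , D₁∩D₂≡⁅e⁆ , D≡D₁∪D₂-e =
    D₁ , D₂ , D₁-circuit , D₂-circuit , D≡D₁⊕D₂ , sizes
    where
    open ≡-Reasoning
    D≡D₁⊕D₂ : D ≡ D₁ ⊕ D₂
    D≡D₁⊕D₂ = begin
      D                         ≡⟨ D≡D₁∪D₂-e ⟩
      (D₁ ∪ D₂) ─ ⁅ e ⁆         ≡⟨ cong ((D₁ ∪ D₂) ─_) D₁∩D₂≡⁅e⁆ ⟨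
      (D₁ ∪ D₂) ─ (D₁ ∩ D₂)     ≡⟨ p∪q─p∩q≡p⊕q D₁ D₂ ⟩
      D₁ ⊕ D₂                   ∎
    e∈D₁∩D₂ : e ∈ D₁ ∩ D₂
    e∈D₁∩D₂ rewrite D₁∩D₂≡⁅e⁆ = x∈⁅x⁆ e
    sizes : ∣ D₁ ∣ + ∣ D₂ ∣ ≡ ∣ D ∣ + 2
    sizes = begin
      ∣ D₁ ∣ + ∣ D₂ ∣                ≡⟨ ∣p∪q∣+∣p∩q∣≡∣p∣+∣q∣ D₁ D₂ ⟨
      ∣ D₁ ∪ D₂ ∣ + ∣ D₁ ∩ D₂ ∣      ≡⟨ cong₂ _+_ (x∈p⇒1+∣p-x∣≡∣p∣ (p⊆p∪q D₂ (p∩q⊆p D₁ D₂ e∈D₁∩D₂)))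
                                                   (sym (trans (cong ∣_∣ D₁∩D₂≡⁅e⁆) (∣⁅x⁆∣≡1 e))) ⟨
      suc ∣ (D₁ ∪ D₂) - e ∣ + 1      ≡⟨ cong (λ E → suc ∣ E ∣ + 1) D≡D₁∪D₂-e ⟨
      suc ∣ D ∣ + 1                  ≡⟨ +-suc ∣ D ∣ 1 ⟨
      ∣ D ∣ + 2                      ∎

  ∑∩≡∑∩∁ : ∀ X → Cycle C → ∑ (C ∩ X) ≡ ∑ (C ∩ ∁ X)
  ∑∩≡∑∩∁ {C} X cyc = ⊕.inverseˡ-unique _ _ (begin
    ∑ (C ∩ X) ⊕ ∑ (C ∩ ∁ X)   ≡⟨ ∑-⊕ (C ∩ X) (C ∩ ∁ X) ⟨
    ∑ (C ∩ X ⊕ C ∩ ∁ X)       ≡⟨ cong ∑ (p∩q⊕p∩∁q≡p C X) ⟩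
    ∑ C                       ≡⟨ cyc ⟩
    zeros                     ∎)
    where open ≡-Reasoning

  ∈⟨cl∩cl⟩ : S ⊆ Z₁ → ∑ S ∈⟨ Z₂ ⟩ → ∣ S ∣ ≤ 1 → ∑ S ∈⟨ cl A Z₁ ∩ cl A Z₂ ⟩
  ∈⟨cl∩cl⟩ {S} {Z₁} {Z₂} S⊆Z₁ ∑S∈⟨Z₂⟩ ∣S∣≤1 = S , S⊆cl∩cl , refl
    where
    S⊆cl∩cl : S ⊆ cl A Z₁ ∩ cl A Z₂
    S⊆cl∩cl {x} x∈S = x∈p∩q⁺
      ( Equivalence.from ∈cl⇔∈⟨⟩ (col∈⟨⟩ (S⊆Z₁ x∈S))
      , Equivalence.from ∈cl⇔∈⟨⟩ (subst (_∈⟨ Z₂ ⟩) (trans (cong ∑ (∣p∣≤1⇒p≡⁅x⁆ ∣S∣≤1 x∈S)) (sumSel-⁅⁆ A x)) ∑S∈⟨Z₂⟩))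

  guts : Subset n → Subset n
  guts X = cl A X ∩ cl A (∁ X)

  module _ (simple : Simple A) (chordal : Chordal A) (X : Subset n) where

    ∑∩∈⟨guts⟩ : Cycle S → ∑ (S ∩ X) ∈⟨ guts X ⟩
    ∑∩∈⟨guts⟩ = cycle-induction (λ S → ∑ (S ∩ X) ∈⟨ guts X ⟩) P⊥ P⊕ P-circuit
      where
      P⊥ : ∑ (⊥ ∩ X) ∈⟨ guts X ⟩
      P⊥ = ⊥ ∩ X , (λ x∈ → contradiction (p∩q⊆p ⊥ X x∈) ∉⊥) , refl
      P⊕ : ∀ {S T} → ∑ (S ∩ X) ∈⟨ guts X ⟩ → ∑ (T ∩ X) ∈⟨ guts X ⟩ → ∑ ((S ⊕ T) ∩ X) ∈⟨ guts X ⟩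
      P⊕ {S} {T} PS PT =
        subst (_∈⟨ guts X ⟩) (sym (trans (cong ∑ (⊕-distribʳ-∩ S T X)) (∑-⊕ (S ∩ X) (T ∩ X)))) (⊕∈⟨⟩ PS PT)
      P-circuit : Circuit A C → (∀ {S} → Cycle S → ∣ S ∣ < ∣ C ∣ → ∑ (S ∩ X) ∈⟨ guts X ⟩) → ∑ (C ∩ X) ∈⟨ guts X ⟩
      P-circuit {C} C-circuit IH with ∣ C ∩ X ∣ ≤? 1 | ∣ C ∩ ∁ X ∣ ≤? 1
      ... | yes small | _ = ∈⟨cl∩cl⟩ (p∩q⊆q C X) (C ∩ ∁ X , p∩q⊆q C (∁ X) , sym (∑∩≡∑∩∁ X (Circuit⇒Cycle C-circuit))) small
      ... | _ | yes small = subst₂ _∈⟨_⟩ (sym cross) (∩-comm _ _)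
                              (∈⟨cl∩cl⟩ (p∩q⊆q C (∁ X)) (C ∩ X , p∩q⊆q C X , cross) small)
        where
        cross : ∑ (C ∩ X) ≡ ∑ (C ∩ ∁ X)
        cross = ∑∩≡∑∩∁ X (Circuit⇒Cycle C-circuit)
      ... | no big | no big′
        with chordal-split chordal C-circuit (subst (4 ≤_) (∣p∩q∣+∣p∩∁q∣≡∣p∣ C X) (+-mono-≤ (≰⇒> big) (≰⇒> big′)))
      ...   | D₁ , D₂ , D₁-circuit , D₂-circuit , C≡D₁⊕D₂ , sizes =
        subst (λ D → ∑ (D ∩ X) ∈⟨ guts X ⟩) (sym C≡D₁⊕D₂)
          (P⊕ (IH (Circuit⇒Cycle D₁-circuit) (m+n≡o+2⇒3≤n⇒m<o sizes (simple D₂ D₂-circuit)))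
              (IH (Circuit⇒Cycle D₂-circuit) (m+n≡o+2⇒3≤n⇒m<o (trans (+-comm ∣ D₂ ∣ ∣ D₁ ∣) sizes) (simple D₁ D₁-circuit))))

    ⟨X⟩∩⟨∁X⟩⊆⟨guts⟩ : v ∈⟨ X ⟩ → v ∈⟨ ∁ X ⟩ → v ∈⟨ guts X ⟩
    ⟨X⟩∩⟨∁X⟩⊆⟨guts⟩ (S , S⊆X , refl) (S′ , S′⊆∁X , ∑S′≡∑S) =
      subst (_∈⟨ guts X ⟩) (cong ∑ S⊕S′∩X≡S) (∑∩∈⟨guts⟩ S⊕S′-cycle)
      where
      S⊕S′-cycle : Cycle (S ⊕ S′)
      S⊕S′-cycle = trans (∑-⊕ S S′) (trans (cong (∑ S ⊕_) ∑S′≡∑S) (⊕-self (∑ S)))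
      S⊕S′∩X≡S : (S ⊕ S′) ∩ X ≡ S
      S⊕S′∩X≡S = trans (⊕-distribʳ-∩ S S′ X) (trans (cong₂ _⊕_ (p⊆q⇒p∩q≡p S⊆X) (p⊆∁q⇒p∩q≡⊥ S′⊆∁X)) (⊕.identityʳ S))

    rank-guts+rankM : rank A (guts X) + rankM A ≡ rank A X + rank A (∁ X)
    rank-guts+rankM = trans (cong (λ E → rank A (guts X) + rank A E) (sym (p∪∁p≡⊤ X)))
      (rank-modular (cl⊆⟨⟩ ∘ p∩q⊆p _ _) (cl⊆⟨⟩ ∘ p∩q⊆q _ _) ⟨X⟩∩⟨∁X⟩⊆⟨guts⟩)

lemma2p4 : ∀ {n m} (A : BinRep n m) (k : ℕ) (X Y : Subset n) →
    2 ≤ k → Simple A → Chordal A → ExactVerticalSep A k X Y →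
    rank A (cl A X ∩ cl A Y) ≡ k ∸ 1
lemma2p4 A k X Y _ simple chordal ((refl , _) , exact) =
  +-cancelʳ-≡ (rankM A) _ _ (trans (rank-guts+rankM simple chordal X) (trans exact (+-comm (rankM A) (k ∸ 1))))
  where open BinaryMatroid A
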